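{- Let $a \ge 3$ be an odd integer, and write the binary expansion of $1/a$ as $0.b_1b_2b_3\ldots$ (which is purely periodic with a minimal period $\ell \le a-1$). Consider the procedure that, for $i = 1,2,\dots$ in increasing order, checks whether the first $2a$ bits of the infinite periodic sequence $b_1\ldots b_i b_1\ldots b_i\ldots$ coincide with $b_1 b_2\ldots b_{2a}$, and returns the first $i$ for which this holds. Then the returned $i$ is such that $b_1\ldots b_i$ is a valid repetend of $1/a$ (i.e. $1/a = 0.\overline{b_1\ldots b_i}$ in binary), and it is a minimum repetend (i.e. $i = \ell$).
   Context: A repetend of a purely periodic binary expansion $0.b_1b_2\ldots$ is a block $b_1\ldots b_i$ such that $b_{j+i} = b_j$ for all $j\ge1$; the minimum repetend is the shortest one. -}

module Defs where

open import Data.Nat using (ℕ; zero; suc; _+_; _*_; _^_; _≤_; _≡ᵇ_)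
open import Data.Nat.DivMod using (_/_; _%_)
open import Data.Bool using (Bool; true; false; if_then_else_)
open import Data.List using (List; map; upTo)
open import Data.Bool.ListAction using (and)
open import Relation.Binary.PropositionalEquality using (_≡_)

-- j-th binary digit (j ≥ 1) of 1/a, i.e. b_j in 1/a = 0.b₁b₂b₃… (base 2):
-- b_j = ⌊2^j / a⌋ mod 2.  (Meaningful for a ≥ 2.)
bit : (a : ℕ) → .{{_ : Data.Nat.NonZero a}} → ℕ → ℕ
bit a j = ((2 ^ j) / a) % 2

IsRepetend : (a : ℕ) → .{{_ : Data.Nat.NonZero a}} → ℕ → Set
IsRepetend a i = 1 ≤ i × (∀ j → 1 ≤ j → bit a (j + i) ≡ bit a j)
  where open import Data.Product using (_×_)

IsMinRepetend : (a : ℕ) → .{{_ : Data.Nat.NonZero a}} → ℕ → Set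
IsMinRepetend a i = IsRepetend a i × (∀ k → IsRepetend a k → i ≤ k)
  where open import Data.Product using (_×_)

-- Test of the procedure for candidate length i = suc k: do the first 2a bits of
-- b₁…bᵢ b₁…bᵢ … coincide with b₁…b_{2a}?  The j-th bit (j ≥ 1) of the periodic
-- sequence is b_{((j-1) mod i) + 1}.
prefixTest : (a : ℕ) → .{{_ : Data.Nat.NonZero a}} → ℕ → Bool
prefixTest a k =
  and (map (λ j → bit a (suc j) ≡ᵇ bit a (suc (j % suc k))) (upTo (2 * a)))

-- The search runs over i = 1 … 2a (i = 2a always passes, so
-- the fuel never runs out; the fallback 0 is unreachable).
search : (a : ℕ) → .{{_ : Data.Nat.NonZero a}} → ℕ → ℕ → ℕ
search a zero k = 0
search a (suc fuel) k = if prefixTest a k then suc k else search a fuel (suc k)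

procedure : (a : ℕ) → .{{_ : Data.Nat.NonZero a}} → ℕ
procedure a = search a (2 * a) 0

{-# OPTIONS --safe #-}
module Submission where

open import Defs
open import Data.Nat using (ℕ; _≤_; NonZero)
open import Data.Nat.Divisibility using (_∣_)
open import Relation.Nullary using (¬_)
open import Data.Product using (_×_)

open import Data.Bool using (T; true; false)
open import Data.Empty using (⊥-elim)
open import Data.Fin using (Fin; toℕ; fromℕ<)
open import Data.Fin.Properties using (pigeonhole; toℕ-fromℕ<; toℕ<n)
open import Data.List using (upTo)
open import Data.List.Relation.Unary.All.Properties using (all⁺; all⁻; applyUpTo⁺₁; applyUpTo⁻)
open import Data.Nat using (zero; suc; _+_; _*_; _^_; _<_; z≤n; s≤s; s≤s⁻¹; _≡ᵇ_)
open import Data.Nat.DivMod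
open import Data.Nat.Divisibility using (∣-trans; m∣m*n; n∣m*n; m%n≡0⇒n∣m)
open import Data.Nat.Properties
open import Data.Product using (∃; _,_; proj₁; proj₂)
open import Data.Sum using (inj₁; inj₂)
open import Data.Unit using (tt)
open import Function using (id; _∘_)
open import Relation.Binary.Definitions using (tri<; tri≈; tri>)
open import Relation.Binary.PropositionalEquality
open import Relation.Nullary using (contradiction)

-- The j-th binary digit of x/a is ⌊2^j x / a⌋ mod 2, and for j ≥ 1 it depends only on
-- x mod a.  As b_{j+i} is the j-th digit of 2^i/a, every i ≥ 1 with 2^i ≡ 1 (mod a) is a
-- repetend.  Conversely, if i ≤ a passes the test, the first a digits of (2^i mod a)/a
-- are those of 1/a; since a ≤ 2^a, the first a digits of x/a determine x < a, so
-- 2^i ≡ 1 (mod a).  As a is odd, 2 is invertible mod a and the pigeonhole principle gives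
-- such an i ≤ a.  Every repetend passes the test, so the first i that passes is at most
-- this one, hence a repetend, and it lies below every other repetend.

n<2^n : ∀ n → n < 2 ^ n
n<2^n zero    = s≤s z≤n
n<2^n (suc n) = begin
  suc (suc n)       ≤⟨ +-mono-≤ (m^n>0 2 n) (n<2^n n) ⟩
  2 ^ n + 2 ^ n     ≡⟨ cong (2 ^ n +_) (sym (+-identityʳ (2 ^ n))) ⟩
  2 ^ suc n         ∎
  where open ≤-Reasoning

module _ (a : ℕ) .{{_ : NonZero a}} where

  [m+ka]/a≡m/a+k : ∀ m k → (m + k * a) / a ≡ m / a + k
  [m+ka]/a≡m/a+k m k = trans (+-distrib-/-∣ʳ m (n∣m*n k)) (cong (m / a +_) (m*n/n≡m k a))

  %-cong-*ˡ : ∀ c {x y} → x % a ≡ y % a → (c * x) % a ≡ (c * y) % a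
  %-cong-*ˡ c {x} {y} x≡y = begin
    (c * x) % a               ≡⟨ %-distribˡ-* c x a ⟩
    (c % a * (x % a)) % a     ≡⟨ cong (λ r → (c % a * r) % a) x≡y ⟩
    (c % a * (y % a)) % a     ≡⟨ %-distribˡ-* c y a ⟨
    (c * y) % a               ∎
    where open ≡-Reasoning

  -- In binary: ⌊x/a⌋ followed by the first j digits of x/a.
  scaled : ℕ → ℕ → ℕ
  scaled x j = (2 ^ j * x) / a

  digit : ℕ → ℕ → ℕ
  digit x j = scaled x j % 2

  bit≡digit-1 : ∀ j → bit a j ≡ digit 1 j
  bit≡digit-1 j = cong (λ n → n / a % 2) (sym (*-identityʳ (2 ^ j)))

  bit-+≡digit-2^ : ∀ j i → bit a (j + i) ≡ digit (2 ^ i) j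
  bit-+≡digit-2^ j i = cong (λ n → n / a % 2) (^-distribˡ-+-* 2 j i)

  digit-+-* : ∀ x q j → digit (x + q * a) (suc j) ≡ digit x (suc j)
  digit-+-* x q j = begin
    (p * (x + q * a)) / a % 2       ≡⟨ cong (λ n → n / a % 2) (*-distribˡ-+ p x (q * a)) ⟩
    (p * x + p * (q * a)) / a % 2   ≡⟨ cong (λ n → (p * x + n) / a % 2) (*-assoc p q a) ⟨
    (p * x + p * q * a) / a % 2     ≡⟨ cong (_% 2) ([m+ka]/a≡m/a+k (p * x) (p * q)) ⟩
    ((p * x) / a + p * q) % 2       ≡⟨ %-remove-+ʳ ((p * x) / a) (∣-trans (m∣m*n (2 ^ j)) (m∣m*n q)) ⟩
    (p * x) / a % 2                 ∎
    where
      open ≡-Reasoning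
      p = 2 ^ suc j

  digit-% : ∀ x j → digit x (suc j) ≡ digit (x % a) (suc j)
  digit-% x j = begin
    digit x (suc j)                       ≡⟨ cong (λ n → digit n (suc j)) (m≡m%n+[m/n]*n x a) ⟩
    digit (x % a + x / a * a) (suc j)     ≡⟨ digit-+-* (x % a) (x / a) j ⟩
    digit (x % a) (suc j)                 ∎
    where open ≡-Reasoning

  /a-double : ∀ y → (2 * y) / a ≡ 2 * (y / a) + (2 * y) / a % 2
  /a-double y = trans split (cong (2 * (y / a) +_) (sym carry≡))
    where
      carry = (2 * (y % a)) / a
      split : (2 * y) / a ≡ 2 * (y / a) + carry
      split = begin
        (2 * y) / a                           ≡⟨ cong (λ n → (2 * n) / a) (m≡m%n+[m/n]*n y a) ⟩
        (2 * (y % a + y / a * a)) / a         ≡⟨ cong (_/ a) (*-distribˡ-+ 2 (y % a) (y / a * a)) ⟩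
        (2 * (y % a) + 2 * (y / a * a)) / a   ≡⟨ cong (λ n → (2 * (y % a) + n) / a) (*-assoc 2 (y / a) a) ⟨
        (2 * (y % a) + 2 * (y / a) * a) / a   ≡⟨ [m+ka]/a≡m/a+k (2 * (y % a)) (2 * (y / a)) ⟩
        carry + 2 * (y / a)                   ≡⟨ +-comm carry (2 * (y / a)) ⟩
        2 * (y / a) + carry                   ∎
        where open ≡-Reasoning
      carry≡ : (2 * y) / a % 2 ≡ carry
      carry≡ = begin
        (2 * y) / a % 2              ≡⟨ cong (_% 2) split ⟩
        (2 * (y / a) + carry) % 2    ≡⟨ %-remove-+ˡ carry (m∣m*n (y / a)) ⟩
        carry % 2                    ≡⟨ m<n⇒m%n≡m (m<n*o⇒m/o<n (*-monoʳ-< 2 (m%n<n y a))) ⟩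
        carry                        ∎
        where open ≡-Reasoning

  scaled-zero : ∀ {x} → x < a → scaled x 0 ≡ 0
  scaled-zero {x} x<a = trans (cong (_/ a) (*-identityˡ x)) (m<n⇒m/n≡0 x<a)

  scaled-suc : ∀ x j → scaled x (suc j) ≡ 2 * scaled x j + digit x (suc j)
  scaled-suc x j = begin
    (2 * 2 ^ j * x) / a                              ≡⟨ cong (_/ a) (*-assoc 2 (2 ^ j) x) ⟩
    (2 * (2 ^ j * x)) / a                            ≡⟨ /a-double (2 ^ j * x) ⟩
    2 * scaled x j + (2 * (2 ^ j * x)) / a % 2       ≡⟨ cong (λ n → 2 * scaled x j + n / a % 2) (*-assoc 2 (2 ^ j) x) ⟨
    2 * scaled x j + digit x (suc j)                 ∎
    where open ≡-Reasoning

  scaled-cong : ∀ {x y} → x < a → y < a → ∀ N →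
    (∀ j → j < N → digit x (suc j) ≡ digit y (suc j)) → scaled x N ≡ scaled y N
  scaled-cong x<a y<a zero _ = trans (scaled-zero x<a) (sym (scaled-zero y<a))
  scaled-cong {x} {y} x<a y<a (suc N) same = begin
    scaled x (suc N)                   ≡⟨ scaled-suc x N ⟩
    2 * scaled x N + digit x (suc N)   ≡⟨ cong₂ (λ u v → 2 * u + v) earlier (same N (n<1+n N)) ⟩
    2 * scaled y N + digit y (suc N)   ≡⟨ scaled-suc y N ⟨
    scaled y (suc N)                   ∎
    where
      open ≡-Reasoning
      earlier = scaled-cong x<a y<a N (λ j j<N → same j (m<n⇒m<1+n j<N))

  scaled-strictMono : ∀ {x y} N → a ≤ 2 ^ N → x < y → scaled x N < scaled y N
  scaled-strictMono {x} {y} N a≤2^N x<y = begin-strict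
    scaled x N                  <⟨ n<1+n (scaled x N) ⟩
    suc (scaled x N)            ≡⟨ +-comm 1 (scaled x N) ⟩
    scaled x N + 1              ≡⟨ [m+ka]/a≡m/a+k (2 ^ N * x) 1 ⟨
    (2 ^ N * x + 1 * a) / a     ≤⟨ /-monoˡ-≤ a gap ⟩
    scaled y N                  ∎
    where
      open ≤-Reasoning
      gap : 2 ^ N * x + 1 * a ≤ 2 ^ N * y
      gap = begin
        2 ^ N * x + 1 * a      ≡⟨ cong (2 ^ N * x +_) (*-identityˡ a) ⟩
        2 ^ N * x + a          ≤⟨ +-monoʳ-≤ (2 ^ N * x) a≤2^N ⟩
        2 ^ N * x + 2 ^ N      ≡⟨ +-comm (2 ^ N * x) (2 ^ N) ⟩
        2 ^ N + 2 ^ N * x      ≡⟨ *-suc (2 ^ N) x ⟨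
        2 ^ N * suc x          ≤⟨ *-monoʳ-≤ (2 ^ N) x<y ⟩
        2 ^ N * y              ∎

  digits-injective : ∀ {x y} N → x < a → y < a → a ≤ 2 ^ N →
    (∀ j → j < N → digit x (suc j) ≡ digit y (suc j)) → x ≡ y
  digits-injective {x} {y} N x<a y<a a≤2^N same with <-cmp x y
  ... | tri< x<y _ _ = ⊥-elim (<-irrefl (scaled-cong x<a y<a N same) (scaled-strictMono N a≤2^N x<y))
  ... | tri≈ _ x≡y _ = x≡y
  ... | tri> _ _ y<x = ⊥-elim (<-irrefl (sym (scaled-cong x<a y<a N same)) (scaled-strictMono N a≤2^N y<x))

  bit-+≡digit-2^% : ∀ i j → bit a (suc j + i) ≡ digit (2 ^ i % a) (suc j)
  bit-+≡digit-2^% i j = trans (bit-+≡digit-2^ (suc j) i) (digit-% (2 ^ i) j)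

  bit≡digit-1% : ∀ j → bit a (suc j) ≡ digit (1 % a) (suc j)
  bit≡digit-1% j = trans (bit≡digit-1 (suc j)) (digit-% 1 j)

  2^i≡1⇒repetend : ∀ {i} → 1 ≤ i → 2 ^ i % a ≡ 1 % a → IsRepetend a i
  2^i≡1⇒repetend {i} 1≤i 2^i≡1 = 1≤i , shift
    where
      shift : ∀ j → 1 ≤ j → bit a (j + i) ≡ bit a j
      shift (suc j) _ = begin
        bit a (suc j + i)            ≡⟨ bit-+≡digit-2^% i j ⟩
        digit (2 ^ i % a) (suc j)    ≡⟨ cong (λ r → digit r (suc j)) 2^i≡1 ⟩
        digit (1 % a) (suc j)        ≡⟨ bit≡digit-1% j ⟨
        bit a (suc j)                ∎
        where open ≡-Reasoning

  repetend-periodic : ∀ {i} → IsRepetend a i → ∀ j → 1 ≤ j → ∀ t → bit a (j + t * i) ≡ bit a j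
  repetend-periodic _ j _ zero = cong (bit a) (+-identityʳ j)
  repetend-periodic {i} rep j 1≤j (suc t) = begin
    bit a (j + (i + t * i))      ≡⟨ cong (λ n → bit a (j + n)) (+-comm i (t * i)) ⟩
    bit a (j + (t * i + i))      ≡⟨ cong (bit a) (+-assoc j (t * i) i) ⟨
    bit a (j + t * i + i)        ≡⟨ proj₂ rep (j + t * i) (≤-trans 1≤j (m≤m+n j (t * i))) ⟩
    bit a (j + t * i)            ≡⟨ repetend-periodic rep j 1≤j t ⟩
    bit a j                      ∎
    where open ≡-Reasoning

  PrefixAgrees : ℕ → Set
  PrefixAgrees k = ∀ j → j < 2 * a → bit a (suc j) ≡ bit a (suc (j % suc k))

  prefixTest⇒agrees : ∀ {k} → T (prefixTest a k) → PrefixAgrees k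
  prefixTest⇒agrees {k} passes j j<2a =
    ≡ᵇ⇒≡ _ _ (applyUpTo⁻ id (2 * a) (all⁺ agreesAt (upTo (2 * a)) passes) j<2a)
    where agreesAt = λ j → bit a (suc j) ≡ᵇ bit a (suc (j % suc k))

  agrees⇒prefixTest : ∀ {k} → PrefixAgrees k → T (prefixTest a k)
  agrees⇒prefixTest {k} agrees =
    all⁻ agreesAt (applyUpTo⁺₁ id (2 * a) (λ {j} j<2a → ≡⇒≡ᵇ _ _ (agrees j j<2a)))
    where agreesAt = λ j → bit a (suc j) ≡ᵇ bit a (suc (j % suc k))

  repetend⇒agrees : ∀ {k} → IsRepetend a (suc k) → PrefixAgrees k
  repetend⇒agrees {k} rep j _ = begin
    bit a (suc j)                                ≡⟨ cong (λ n → bit a (suc n)) (m≡m%n+[m/n]*n j (suc k)) ⟩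
    bit a (suc (j % suc k) + j / suc k * suc k)  ≡⟨ repetend-periodic rep (suc (j % suc k)) (s≤s z≤n) (j / suc k) ⟩
    bit a (suc (j % suc k))                      ∎
    where open ≡-Reasoning

  agrees⇒2^[1+k]≡1 : ∀ {k} → PrefixAgrees k → suc k ≤ a → 2 ^ suc k % a ≡ 1 % a
  agrees⇒2^[1+k]≡1 {k} agrees i≤a =
    digits-injective a (m%n<n (2 ^ i) a) (m%n<n 1 a) (<⇒≤ (n<2^n a)) sameDigits
    where
      i = suc k
      sameDigits : ∀ j → j < a → digit (2 ^ i % a) (suc j) ≡ digit (1 % a) (suc j)
      sameDigits j j<a = begin
        digit (2 ^ i % a) (suc j)      ≡⟨ bit-+≡digit-2^% i j ⟨
        bit a (suc (j + i))            ≡⟨ agrees (j + i) (+-mono-<-≤ j<a (subst (i ≤_) (sym (+-identityʳ a)) i≤a)) ⟩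
        bit a (suc ((j + i) % i))      ≡⟨ cong (λ n → bit a (suc n)) ([m+n]%n≡m%n j i) ⟩
        bit a (suc (j % i))            ≡⟨ agrees j (≤-trans j<a (m≤m+n a (a + 0))) ⟨
        bit a (suc j)                  ≡⟨ bit≡digit-1% j ⟩
        digit (1 % a) (suc j)          ∎
        where open ≡-Reasoning

  odd⇒2*h≡1+a : ¬ 2 ∣ a → ∃ λ h → 2 * h ≡ suc a
  odd⇒2*h≡1+a odd with a % 2 in a%2 | m%n<n a 2
  ... | 0 | _ = ⊥-elim (odd (m%n≡0⇒n∣m a 2 a%2))
  ... | 1 | _ = suc (a / 2) , (begin
    2 * suc (a / 2)          ≡⟨ *-suc 2 (a / 2) ⟩
    2 + 2 * (a / 2)          ≡⟨ cong (2 +_) (*-comm 2 (a / 2)) ⟩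
    suc (1 + a / 2 * 2)      ≡⟨ cong (λ r → suc (r + a / 2 * 2)) a%2 ⟨
    suc (a % 2 + a / 2 * 2)  ≡⟨ cong suc (m≡m%n+[m/n]*n a 2) ⟨
    suc a                    ∎)
    where open ≡-Reasoning
  ... | suc (suc _) | s≤s (s≤s ())

  2*-cancel-% : ¬ 2 ∣ a → ∀ x y → (2 * x) % a ≡ (2 * y) % a → x % a ≡ y % a
  2*-cancel-% odd x y 2x≡2y = begin
    x % a                  ≡⟨ halve x ⟨
    (h * (2 * x)) % a      ≡⟨ %-cong-*ˡ h 2x≡2y ⟩
    (h * (2 * y)) % a      ≡⟨ halve y ⟩
    y % a                  ∎
    where
      open ≡-Reasoning
      h = proj₁ (odd⇒2*h≡1+a odd)
      halve : ∀ z → (h * (2 * z)) % a ≡ z % a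
      halve z = begin
        (h * (2 * z)) % a   ≡⟨ cong (_% a) (*-assoc h 2 z) ⟨
        (h * 2 * z) % a     ≡⟨ cong (λ n → (n * z) % a) (trans (*-comm h 2) (proj₂ (odd⇒2*h≡1+a odd))) ⟩
        (z + a * z) % a     ≡⟨ cong (λ n → (z + n) % a) (*-comm a z) ⟩
        (z + z * a) % a     ≡⟨ [m+kn]%n≡m%n z z a ⟩
        z % a               ∎

  2^*-cancel-% : ¬ 2 ∣ a → ∀ s x y → (2 ^ s * x) % a ≡ (2 ^ s * y) % a → x % a ≡ y % a
  2^*-cancel-% _ zero x y x≡y =
    trans (cong (_% a) (sym (*-identityˡ x))) (trans x≡y (cong (_% a) (*-identityˡ y)))
  2^*-cancel-% odd (suc s) x y 2^sx≡2^sy = 2^*-cancel-% odd s x y (2*-cancel-% odd _ _ (begin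
    (2 * (2 ^ s * x)) % a     ≡⟨ cong (_% a) (*-assoc 2 (2 ^ s) x) ⟨
    (2 ^ suc s * x) % a       ≡⟨ 2^sx≡2^sy ⟩
    (2 ^ suc s * y) % a       ≡⟨ cong (_% a) (*-assoc 2 (2 ^ s) y) ⟩
    (2 * (2 ^ s * y)) % a     ∎))
    where open ≡-Reasoning

  collision⇒period : ¬ 2 ∣ a → ∀ {i j} → i < j → j ≤ a → 2 ^ i % a ≡ 2 ^ j % a →
    ∃ λ k → suc k ≤ a × 2 ^ suc k % a ≡ 1 % a
  collision⇒period odd {i} {j} i<j j≤a 2^i≡2^j
    with k , i+1+k≡j ← m≤n⇒∃[o]m+o≡n i<j =
    k , ≤-trans (m≤n+m (suc k) i) (subst (_≤ a) (sym i+[1+k]≡j) j≤a) ,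
    2^*-cancel-% odd i (2 ^ suc k) 1 (begin
      (2 ^ i * 2 ^ suc k) % a     ≡⟨ cong (_% a) (^-distribˡ-+-* 2 i (suc k)) ⟨
      2 ^ (i + suc k) % a         ≡⟨ cong (λ n → 2 ^ n % a) i+[1+k]≡j ⟩
      2 ^ j % a                   ≡⟨ 2^i≡2^j ⟨
      2 ^ i % a                   ≡⟨ cong (_% a) (*-identityʳ (2 ^ i)) ⟨
      (2 ^ i * 1) % a             ∎)
    where
      open ≡-Reasoning
      i+[1+k]≡j : i + suc k ≡ j
      i+[1+k]≡j = trans (+-suc i k) i+1+k≡j

  residue-2^ : ℕ → Fin a
  residue-2^ n = fromℕ< (m%n<n (2 ^ n) a)

  period-exists : ¬ 2 ∣ a → ∃ λ k → suc k ≤ a × 2 ^ suc k % a ≡ 1 % a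
  period-exists odd with i , j , i<j , same ← pigeonhole (n<1+n a) (residue-2^ ∘ toℕ) =
    collision⇒period odd i<j (s≤s⁻¹ (toℕ<n j)) (begin
      2 ^ toℕ i % a              ≡⟨ toℕ-fromℕ< (m%n<n (2 ^ toℕ i) a) ⟨
      toℕ (residue-2^ (toℕ i))   ≡⟨ cong toℕ same ⟩
      toℕ (residue-2^ (toℕ j))   ≡⟨ toℕ-fromℕ< (m%n<n (2 ^ toℕ j) a) ⟩
      2 ^ toℕ j % a              ∎)
    where open ≡-Reasoning

  Passes : ℕ → Set
  Passes k = T (prefixTest a k)

  search-least : ∀ fuel k {m} → search a fuel k ≡ suc m →
    Passes m × (∀ m′ → k ≤ m′ → m′ < m → ¬ Passes m′)
  search-least (suc fuel) k eq with prefixTest a k in passes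
  search-least (suc fuel) k refl | true =
    subst T (sym passes) tt , λ m′ k≤m′ m′<k → contradiction k≤m′ (<⇒≱ m′<k)
  search-least (suc fuel) k eq | false with search-least fuel (suc k) eq
  ... | found , later = found , earlier
    where
      earlier : ∀ m′ → k ≤ m′ → m′ < _ → ¬ Passes m′
      earlier m′ k≤m′ m′<m with m≤n⇒m<n∨m≡n k≤m′
      ... | inj₁ k<m′ = later m′ k<m′ m′<m
      ... | inj₂ refl = subst T passes

  search-succeeds : ∀ fuel k {m} → Passes m → k ≤ m → m < k + fuel →
    ∃ λ m₀ → search a fuel k ≡ suc m₀
  search-succeeds zero k {m} _ k≤m m<k+0 = ⊥-elim (<⇒≱ (subst (m <_) (+-identityʳ k) m<k+0) k≤m)
  search-succeeds (suc fuel) k {m} pm k≤m m<k+1+fuel with prefixTest a k in passes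
  ... | true = k , refl
  ... | false with m≤n⇒m<n∨m≡n k≤m
  ...   | inj₁ k<m = search-succeeds fuel (suc k) pm k<m (subst (m <_) (+-suc k fuel) m<k+1+fuel)
  ...   | inj₂ refl = ⊥-elim (subst T passes pm)

  repetend⇒passes : ∀ {k} → IsRepetend a (suc k) → Passes k
  repetend⇒passes = agrees⇒prefixTest ∘ repetend⇒agrees

  least-passing⇒minRepetend : ¬ 2 ∣ a → ∀ {m} → Passes m → (∀ m′ → m′ < m → ¬ Passes m′) →
    IsMinRepetend a (suc m)
  least-passing⇒minRepetend odd {m} pm least = repetend , minimal
    where
      least-≤ : ∀ {k} → Passes k → m ≤ k
      least-≤ {k} pk = ≮⇒≥ (λ k<m → least k k<m pk)
      repetend : IsRepetend a (suc m)
      repetend with k , 1+k≤a , period ← period-exists odd =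
        2^i≡1⇒repetend (s≤s z≤n) (agrees⇒2^[1+k]≡1 (prefixTest⇒agrees pm) (≤-trans (s≤s m≤k) 1+k≤a))
        where
          m≤k : m ≤ k
          m≤k = least-≤ (repetend⇒passes (2^i≡1⇒repetend (s≤s z≤n) period))
      minimal : ∀ n → IsRepetend a n → suc m ≤ n
      minimal zero (() , _)
      minimal (suc k) rep = s≤s (least-≤ (repetend⇒passes rep))

lemma1 : (a : ℕ) → .{{_ : NonZero a}} → 3 ≤ a → ¬ (2 ∣ a) →
    IsRepetend a (procedure a) × IsMinRepetend a (procedure a)
-- The argument works for every odd a.
lemma1 a _ odd with k , 1+k≤a , period ← period-exists a odd
  with m , found ← search-succeeds a (2 * a) 0 (repetend⇒passes a (2^i≡1⇒repetend a (s≤s z≤n) period))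
                     z≤n (≤-trans 1+k≤a (m≤m+n a (a + 0))) =
  subst (λ i → IsRepetend a i × IsMinRepetend a i) (sym found) (proj₁ minRepetend , minRepetend)
  where
    minRepetend : IsMinRepetend a (suc m)
    minRepetend with passes , least ← search-least a (2 * a) 0 found =
      least-passing⇒minRepetend a odd passes (λ m′ → least m′ z≤n)
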